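{- Let $A$ and $B$ be diversified formulae of $\mathcal{L}_{\wedge,\vee}$. Then $A\leftrightarrow B$ is a tautology if and only if $A\leftrightarrow B$ is a theorem of the system $\mathcal{S}_{\wedge,\vee}$.
   Context: $\mathcal{L}_{\wedge,\vee}$ is the propositional language generated from an infinite set of propositional letters by the binary connectives $\wedge$ and $\vee$. A formula is diversified when every letter occurs in it at most once. Tautology means classical tautology, with $\leftrightarrow$ material equivalence. The formal system $\mathcal{S}_{\wedge,\vee}$ derives expressions $A\leftrightarrow B$ with $A,B$ in $\mathcal{L}_{\wedge,\vee}$; its axioms are all instances of $A\leftrightarrow A$, $((A\wedge B)\wedge C)\leftrightarrow(A\wedge(B\wedge C))$, $((A\vee B)\vee C)\leftrightarrow(A\vee(B\vee C))$, $(A\wedge B)\leftrightarrow(B\wedge A)$, $(A\vee B)\leftrightarrow(B\vee A)$, and its rules are: from $A\leftrightarrow B$ infer $B\leftrightarrow A$; from $A\leftrightarrow B$ and $B\leftrightarrow C$ infer $A\leftrightarrow C$; from $A\leftrightarrow B$ and $C\leftrightarrow D$ infer $(A\wedge C)\leftrightarrow(B\wedge D)$ and $(A\vee C)\leftrightarrow(B\vee D)$. -}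

module Defs where

open import Data.Nat using (ℕ)
open import Data.Bool using (Bool; _∧_; _∨_)
open import Data.List using (List; []; [_]; _++_)
open import Data.List.Relation.Unary.Unique.Propositional using (Unique)
open import Relation.Binary.PropositionalEquality using (_≡_)

data Formula : Set where
  var  : ℕ → Formula
  _∧'_ : Formula → Formula → Formula
  _∨'_ : Formula → Formula → Formula

infixr 6 _∧'_
infixr 5 _∨'_

letters : Formula → List ℕ
letters (var p)  = [ p ]
letters (A ∧' B) = letters A ++ letters B
letters (A ∨' B) = letters A ++ letters B

Diversified : Formula → Set
Diversified A = Unique (letters A)

Valuation : Set
Valuation = ℕ → Bool

eval : Valuation → Formula → Bool
eval v (var p)  = v p
eval v (A ∧' B) = eval v A ∧ eval v B
eval v (A ∨' B) = eval v A ∨ eval v B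

Tautology↔ : Formula → Formula → Set
Tautology↔ A B = (v : Valuation) → eval v A ≡ eval v B

infix 4 _⊢↔_
data _⊢↔_ : Formula → Formula → Set where
  ax-refl    : ∀ {A} → A ⊢↔ A
  ax-assoc∧  : ∀ {A B C} → ((A ∧' B) ∧' C) ⊢↔ (A ∧' (B ∧' C))
  ax-assoc∨  : ∀ {A B C} → ((A ∨' B) ∨' C) ⊢↔ (A ∨' (B ∨' C))
  ax-comm∧   : ∀ {A B} → (A ∧' B) ⊢↔ (B ∧' A)
  ax-comm∨   : ∀ {A B} → (A ∨' B) ⊢↔ (B ∨' A)
  r-sym      : ∀ {A B} → A ⊢↔ B → B ⊢↔ A
  r-trans    : ∀ {A B C} → A ⊢↔ B → B ⊢↔ C → A ⊢↔ C
  r-cong∧    : ∀ {A B C D} → A ⊢↔ B → C ⊢↔ D → (A ∧' C) ⊢↔ (B ∧' D)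
  r-cong∨    : ∀ {A B C D} → A ⊢↔ B → C ⊢↔ D → (A ∨' C) ⊢↔ (B ∨' D)

-- Call a letter p essential in F when some valuation of the other letters turns F into p,
-- and say that F joins p and q by c when some valuation of the other letters turns F
-- into p ⟨ c ⟩ q. In a diversified formula every letter is essential, so tautologous
-- diversified formulae have the same letters, and any two letters on either side of a
-- c-node are joined by c. Joining is invariant under tautology, while two letters on
-- either side of a c′-node can only be joined by c′, because x ∧ y is not of the form
-- f x ∨ g y, nor x ∨ y of the form f x ∧ g y. So if A₁ ⟨ c ⟩ A₂ is tautologous to B, the
-- root of the smallest subformula of B containing a letter of A₁ and one of A₂ is a c-node,
-- and reassociating and commuting along c-nodes rewrites B into X ⟨ c ⟩ Y where X carries
-- the letters of A₁ and Y those of A₂. Giving the letters of A₂ the unit of c shows that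
-- A₁ and X are tautologous, likewise A₂ and Y, and induction on A concludes.
module Submission where

open import Data.Bool using (Bool; true; false; _∧_; _∨_; if_then_else_)
open import Data.Bool.Properties
  using (∧-comm; ∨-comm; ∧-assoc; ∨-assoc; ∧-idem; ∨-idem; ∧-identityʳ; ∨-identityʳ;
         ∧-zeroʳ; ∨-zeroʳ; ∧-conicalˡ; ∧-conicalʳ; ∨-conicalˡ; ∨-conicalʳ)
open import Data.Empty using (⊥-elim)
open import Data.Nat using (ℕ; _≟_)
open import Data.List using (List; []; _∷_; _++_)
import Data.List.Properties as List
open import Data.List.Membership.Propositional using (_∈_)
open import Data.List.Membership.Propositional.Properties using (∈-++⁺ˡ; ∈-++⁺ʳ; ∈-++⁻)
open import Data.List.Membership.DecPropositional _≟_ using (_∈?_)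
open import Data.List.Relation.Binary.Disjoint.Propositional using (Disjoint)
import Data.List.Relation.Binary.Disjoint.Propositional.Properties as Disjoint
open import Data.List.Relation.Binary.Permutation.Propositional
  using (_↭_; ↭-refl; ↭-reflexive; ↭-sym; ↭-trans; ↭⇒↭ₛ)
open import Data.List.Relation.Binary.Permutation.Propositional.Properties using (++-comm; ++⁺)
open import Data.List.Relation.Unary.All as All using ()
open import Data.List.Relation.Unary.AllPairs using (_∷_)
open import Data.List.Relation.Unary.Any using (here; there)
open import Data.List.Relation.Unary.Unique.Propositional using (Unique; [])
open import Data.Product using (∃; _×_; _,_)
open import Data.Sum using (_⊎_; inj₁; inj₂; [_,_])
open import Function using (_∘_; const; id)
open import Function.Bundles using (_⇔_; mk⇔)
open import Level using (0ℓ)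
open import Relation.Binary.PropositionalEquality
  using (_≡_; refl; sym; trans; cong; cong₂; module ≡-Reasoning)
open import Relation.Binary.PropositionalEquality.Properties using (setoid)
open import Data.List.Relation.Binary.Permutation.Setoid.Properties (setoid ℕ)
  using (Unique-resp-↭)
open import Relation.Nullary using (¬_; Dec; yes; no; does; contradiction)
open import Relation.Nullary.Decidable using (decidable-stable)
open import Relation.Unary using (Pred; Decidable; _⊆_; ∁)
open import Relation.Unary.Properties using (∁?)

open import Defs

variable
  A B C D : Formula
  p q x : ℕ
  b : Bool
  ys : List ℕ
  v w : Valuation

data Connective : Set where
  ∧ᶜ ∨ᶜ : Connective

_≟ᶜ_ : (c c′ : Connective) → Dec (c ≡ c′)
∧ᶜ ≟ᶜ ∧ᶜ = yes refl
∧ᶜ ≟ᶜ ∨ᶜ = no λ ()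
∨ᶜ ≟ᶜ ∧ᶜ = no λ ()
∨ᶜ ≟ᶜ ∨ᶜ = yes refl

infixr 5 _⟨_⟩_

_⟨_⟩_ : Formula → Connective → Formula → Formula
A ⟨ ∧ᶜ ⟩ B = A ∧' B
A ⟨ ∨ᶜ ⟩ B = A ∨' B

⟦_⟧ : Connective → Bool → Bool → Bool
⟦ ∧ᶜ ⟧ = _∧_
⟦ ∨ᶜ ⟧ = _∨_

unit : Connective → Bool
unit ∧ᶜ = true
unit ∨ᶜ = false

variable
  c c′ : Connective

⟦⟧-comm : ∀ c a b → ⟦ c ⟧ a b ≡ ⟦ c ⟧ b a
⟦⟧-comm ∧ᶜ = ∧-comm
⟦⟧-comm ∨ᶜ = ∨-comm

⟦⟧-identityʳ : ∀ c a → ⟦ c ⟧ a (unit c) ≡ a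
⟦⟧-identityʳ ∧ᶜ = ∧-identityʳ
⟦⟧-identityʳ ∨ᶜ = ∨-identityʳ

-- A constant operand either passes the other one through or absorbs it, and no
-- connective is constant.
⟦⟧-cancelʳ : ∀ c′ k c (g : Bool → Bool → Bool) →
             (∀ a b → ⟦ c′ ⟧ (g a b) k ≡ ⟦ c ⟧ a b) → ∀ a b → g a b ≡ ⟦ c ⟧ a b
⟦⟧-cancelʳ ∧ᶜ true  c g h a b = trans (sym (∧-identityʳ _)) (h a b)
⟦⟧-cancelʳ ∨ᶜ false c g h a b = trans (sym (∨-identityʳ _)) (h a b)
⟦⟧-cancelʳ ∧ᶜ false ∧ᶜ g h with trans (sym (∧-zeroʳ _)) (h true true)
... | ()
⟦⟧-cancelʳ ∧ᶜ false ∨ᶜ g h with trans (sym (∧-zeroʳ _)) (h true true)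
... | ()
⟦⟧-cancelʳ ∨ᶜ true ∧ᶜ g h with trans (sym (∨-zeroʳ _)) (h false false)
... | ()
⟦⟧-cancelʳ ∨ᶜ true ∨ᶜ g h with trans (sym (∨-zeroʳ _)) (h false false)
... | ()

⟦⟧-factor : ∀ c′ c (α β : Bool → Bool) → (∀ a b → ⟦ c′ ⟧ (α a) (β b) ≡ ⟦ c ⟧ a b) → c′ ≡ c
⟦⟧-factor ∧ᶜ ∧ᶜ α β h = refl
⟦⟧-factor ∨ᶜ ∨ᶜ α β h = refl
⟦⟧-factor ∧ᶜ ∨ᶜ α β h
  with trans (sym (cong₂ _∧_ (∧-conicalˡ (α false) (β true) (h false true))
                             (∧-conicalʳ (α true) (β false) (h true false))))
             (h false false)
... | ()
⟦⟧-factor ∨ᶜ ∧ᶜ α β h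
  with trans (sym (cong₂ _∨_ (∨-conicalˡ (α true) (β false) (h true false))
                             (∨-conicalʳ (α false) (β true) (h false true))))
             (h true true)
... | ()

infix 4 _∈ᶠ_

_∈ᶠ_ : ℕ → Formula → Set
p ∈ᶠ F = p ∈ letters F

letters-⟨⟩ : ∀ c A B → letters (A ⟨ c ⟩ B) ≡ letters A ++ letters B
letters-⟨⟩ ∧ᶜ A B = refl
letters-⟨⟩ ∨ᶜ A B = refl

∈-⟨⟩⁻ : ∀ c A B → p ∈ᶠ A ⟨ c ⟩ B → p ∈ᶠ A ⊎ p ∈ᶠ B
∈-⟨⟩⁻ c A B rewrite letters-⟨⟩ c A B = ∈-++⁻ (letters A)

∈-⟨⟩⁺ˡ : ∀ c B → p ∈ᶠ A → p ∈ᶠ A ⟨ c ⟩ B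
∈-⟨⟩⁺ˡ {A = A} c B rewrite letters-⟨⟩ c A B = ∈-++⁺ˡ

∈-⟨⟩⁺ʳ : ∀ c A → p ∈ᶠ B → p ∈ᶠ A ⟨ c ⟩ B
∈-⟨⟩⁺ʳ {B = B} c A rewrite letters-⟨⟩ c A B = ∈-++⁺ʳ (letters A)

some-letter : ∀ F → ∃ (_∈ᶠ F)
some-letter (var p)  = p , here refl
some-letter (A ∧' _) = let p , p∈A = some-letter A in p , ∈-++⁺ˡ p∈A
some-letter (A ∨' _) = let p , p∈A = some-letter A in p , ∈-++⁺ˡ p∈A

⊆-⟨⟩ : ∀ {Q : Pred ℕ 0ℓ} c A B → (_∈ᶠ A) ⊆ Q → (_∈ᶠ B) ⊆ Q → (_∈ᶠ A ⟨ c ⟩ B) ⊆ Q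
⊆-⟨⟩ c A B A⊆Q B⊆Q = [ A⊆Q , B⊆Q ] ∘ ∈-⟨⟩⁻ c A B

Unique-++⁻ : ∀ xs → Unique (xs ++ ys) → Unique xs × Unique ys × Disjoint xs ys
Unique-++⁻ [] u = [] , u , λ ()
Unique-++⁻ (x ∷ xs) (x∉ ∷ u) =
  let uxs , uys , xs#ys = Unique-++⁻ xs u in
  All.tabulate (All.lookup x∉ ∘ ∈-++⁺ˡ) ∷ uxs , uys ,
  λ { (here refl , m) → All.lookup x∉ (∈-++⁺ʳ xs m) refl ; (there n , m) → xs#ys (n , m) }

Diversified-⟨⟩⁻ : ∀ c A B → Diversified (A ⟨ c ⟩ B) →
                  Diversified A × Diversified B × Disjoint (letters A) (letters B)
Diversified-⟨⟩⁻ c A B rewrite letters-⟨⟩ c A B = Unique-++⁻ (letters A)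

module _ {P : Pred ℕ 0ℓ} (P? : Decidable P) where
  -- Opaque, so that implicit valuations can be inferred from goals built with choose.
  opaque
   choose : Valuation → Valuation → Valuation
   choose v w x = if does (P? x) then v x else w x

   choose-yes : P x → choose v w x ≡ v x
   choose-yes {x = x} px with P? x
   ... | yes _  = refl
   ... | no ¬px = ⊥-elim (¬px px)

   choose-no : ¬ P x → choose v w x ≡ w x
   choose-no {x = x} ¬px with P? x
   ... | yes px = ⊥-elim (¬px px)
   ... | no _   = refl

   choose-cong : ∀ {v′ w′} → v x ≡ v′ x → w x ≡ w′ x → choose v w x ≡ choose v′ w′ x
   choose-cong {x = x} e e′ with P? x
   ... | yes _ = e
   ... | no _  = e′

infixl 9 _[_≔_]

_[_≔_] : Valuation → ℕ → Bool → Valuation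
v [ p ≔ b ] = choose (_≟ p) (const b) v

update-≡ : ∀ p b → (v [ p ≔ b ]) p ≡ b
update-≡ p b = choose-yes (_≟ p) refl

update-≢ : ¬ x ≡ p → (v [ p ≔ b ]) x ≡ v x
update-≢ {p = p} = choose-no (_≟ p)

update-cong : ∀ p b → v x ≡ w x → (v [ p ≔ b ]) x ≡ (w [ p ≔ b ]) x
update-cong p b = choose-cong (_≟ p) refl

eval-⟨⟩ : ∀ c A B → eval v (A ⟨ c ⟩ B) ≡ ⟦ c ⟧ (eval v A) (eval v B)
eval-⟨⟩ ∧ᶜ A B = refl
eval-⟨⟩ ∨ᶜ A B = refl

eval-cong : ∀ F → (∀ {x} → x ∈ᶠ F → v x ≡ w x) → eval v F ≡ eval w F
eval-cong (var p)  h = h (here refl)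
eval-cong (A ∧' B) h = cong₂ _∧_ (eval-cong A (h ∘ ∈-++⁺ˡ)) (eval-cong B (h ∘ ∈-++⁺ʳ (letters A)))
eval-cong (A ∨' B) h = cong₂ _∨_ (eval-cong A (h ∘ ∈-++⁺ˡ)) (eval-cong B (h ∘ ∈-++⁺ʳ (letters A)))

eval-const : ∀ F b → (∀ {x} → x ∈ᶠ F → v x ≡ b) → eval v F ≡ b
eval-const (var p)  b h = h (here refl)
eval-const (A ∧' B) b h =
  trans (cong₂ _∧_ (eval-const A b (h ∘ ∈-++⁺ˡ)) (eval-const B b (h ∘ ∈-++⁺ʳ (letters A)))) (∧-idem b)
eval-const (A ∨' B) b h =
  trans (cong₂ _∨_ (eval-const A b (h ∘ ∈-++⁺ˡ)) (eval-const B b (h ∘ ∈-++⁺ʳ (letters A)))) (∨-idem b)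

eval-unitʳ : ∀ c A B → (∀ {x} → x ∈ᶠ B → v x ≡ unit c) → eval v (A ⟨ c ⟩ B) ≡ eval v A
eval-unitʳ {v} c A B h = begin
  eval v (A ⟨ c ⟩ B)                ≡⟨ eval-⟨⟩ c A B ⟩
  ⟦ c ⟧ (eval v A) (eval v B)       ≡⟨ cong (⟦ c ⟧ _) (eval-const B (unit c) h) ⟩
  ⟦ c ⟧ (eval v A) (unit c)         ≡⟨ ⟦⟧-identityʳ c _ ⟩
  eval v A                          ∎
  where open ≡-Reasoning

⟨⟩-comm-tautology : ∀ c A B → Tautology↔ (A ⟨ c ⟩ B) (B ⟨ c ⟩ A)
⟨⟩-comm-tautology c A B v =
  trans (eval-⟨⟩ c A B) (trans (⟦⟧-comm c _ _) (sym (eval-⟨⟩ c B A)))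

soundness : A ⊢↔ B → Tautology↔ A B
soundness ax-refl v = refl
soundness (ax-assoc∧ {A} {B} {C}) v = ∧-assoc (eval v A) (eval v B) (eval v C)
soundness (ax-assoc∨ {A} {B} {C}) v = ∨-assoc (eval v A) (eval v B) (eval v C)
soundness (ax-comm∧ {A} {B}) v = ∧-comm (eval v A) (eval v B)
soundness (ax-comm∨ {A} {B}) v = ∨-comm (eval v A) (eval v B)
soundness (r-sym d) v = sym (soundness d v)
soundness (r-trans d e) v = trans (soundness d v) (soundness e v)
soundness (r-cong∧ d e) v = cong₂ _∧_ (soundness d v) (soundness e v)
soundness (r-cong∨ d e) v = cong₂ _∨_ (soundness d v) (soundness e v)

⊢-assoc : ∀ c → (A ⟨ c ⟩ B) ⟨ c ⟩ C ⊢↔ A ⟨ c ⟩ (B ⟨ c ⟩ C)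
⊢-assoc ∧ᶜ = ax-assoc∧
⊢-assoc ∨ᶜ = ax-assoc∨

⊢-comm : ∀ c → A ⟨ c ⟩ B ⊢↔ B ⟨ c ⟩ A
⊢-comm ∧ᶜ = ax-comm∧
⊢-comm ∨ᶜ = ax-comm∨

⊢-cong : ∀ c → A ⊢↔ B → C ⊢↔ D → A ⟨ c ⟩ C ⊢↔ B ⟨ c ⟩ D
⊢-cong ∧ᶜ = r-cong∧
⊢-cong ∨ᶜ = r-cong∨

⊢-swapʳ : ∀ c → (A ⟨ c ⟩ B) ⟨ c ⟩ C ⊢↔ (A ⟨ c ⟩ C) ⟨ c ⟩ B
⊢-swapʳ c = r-trans (⊢-assoc c) (r-trans (⊢-cong c ax-refl (⊢-comm c)) (r-sym (⊢-assoc c)))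

⊢-swapˡ : ∀ c → A ⟨ c ⟩ (B ⟨ c ⟩ C) ⊢↔ B ⟨ c ⟩ (A ⟨ c ⟩ C)
⊢-swapˡ c = r-trans (r-sym (⊢-assoc c)) (r-trans (⊢-cong c (⊢-comm c) ax-refl) (⊢-assoc c))

⊢-medial : ∀ c → (A ⟨ c ⟩ B) ⟨ c ⟩ (C ⟨ c ⟩ D) ⊢↔ (A ⟨ c ⟩ C) ⟨ c ⟩ (B ⟨ c ⟩ D)
⊢-medial c = r-trans (⊢-assoc c) (r-trans (⊢-cong c ax-refl (⊢-swapˡ c)) (r-sym (⊢-assoc c)))

letters-↭ : A ⊢↔ B → letters A ↭ letters B
letters-↭ ax-refl = ↭-refl
letters-↭ (ax-assoc∧ {A} {B} {C}) = ↭-reflexive (List.++-assoc (letters A) (letters B) (letters C))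
letters-↭ (ax-assoc∨ {A} {B} {C}) = ↭-reflexive (List.++-assoc (letters A) (letters B) (letters C))
letters-↭ (ax-comm∧ {A} {B}) = ++-comm (letters A) (letters B)
letters-↭ (ax-comm∨ {A} {B}) = ++-comm (letters A) (letters B)
letters-↭ (r-sym d) = ↭-sym (letters-↭ d)
letters-↭ (r-trans d e) = ↭-trans (letters-↭ d) (letters-↭ e)
letters-↭ (r-cong∧ d e) = ++⁺ (letters-↭ d) (letters-↭ e)
letters-↭ (r-cong∨ d e) = ++⁺ (letters-↭ d) (letters-↭ e)

Diversified-resp-⊢↔ : A ⊢↔ B → Diversified A → Diversified B
Diversified-resp-⊢↔ d = Unique-resp-↭ (↭⇒↭ₛ (letters-↭ d))

eval-update-∉ : ∀ F → ¬ p ∈ᶠ F → eval (v [ p ≔ b ]) F ≡ eval v F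
eval-update-∉ F p∉F = eval-cong F λ x∈F → update-≢ λ { refl → p∉F x∈F }

eval-update-∉-under : ∀ F → ¬ p ∈ᶠ F → ∀ a b → eval (v [ p ≔ a ] [ q ≔ b ]) F ≡ eval (v [ q ≔ b ]) F
eval-update-∉-under {q = q} F p∉F a b =
  eval-cong F λ x∈F → update-cong q b (update-≢ λ { refl → p∉F x∈F })

record Essential (F : Formula) (p : ℕ) : Set where
  constructor _,_
  field
    valuation : Valuation
    isolates  : ∀ b → eval (valuation [ p ≔ b ]) F ≡ b

Essential-resp : Tautology↔ A B → Essential A p → Essential B p
Essential-resp t (v , h) = v , λ b → trans (sym (t _)) (h b)

essential-⟨⟩ˡ : ∀ c A B → Disjoint (letters A) (letters B) → p ∈ᶠ A →
                Essential A p → Essential (A ⟨ c ⟩ B) p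
essential-⟨⟩ˡ {p} c A B A#B p∈A (v , h) = u , λ b → begin
  eval (u [ p ≔ b ]) (A ⟨ c ⟩ B)  ≡⟨ eval-unitʳ c A B (unit-on-B b) ⟩
  eval (u [ p ≔ b ]) A            ≡⟨ eval-cong A (λ x∈A → update-cong p b (choose-yes (_∈? letters A) x∈A)) ⟩
  eval (v [ p ≔ b ]) A            ≡⟨ h b ⟩
  b                               ∎
  where
  open ≡-Reasoning
  u = choose (_∈? letters A) v (const (unit c))
  unit-on-B : ∀ b {x} → x ∈ᶠ B → (u [ p ≔ b ]) x ≡ unit c
  unit-on-B b x∈B =
    trans (update-≢ λ { refl → A#B (p∈A , x∈B) }) (choose-no (_∈? letters A) λ x∈A → A#B (x∈A , x∈B))

essential-⟨⟩ : ∀ c A B → (∀ {p} → Diversified A → p ∈ᶠ A → Essential A p) →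
               (∀ {p} → Diversified B → p ∈ᶠ B → Essential B p) →
               Diversified (A ⟨ c ⟩ B) → p ∈ᶠ A ⟨ c ⟩ B → Essential (A ⟨ c ⟩ B) p
essential-⟨⟩ c A B essA essB d p∈ with Diversified-⟨⟩⁻ c A B d | ∈-⟨⟩⁻ c A B p∈
... | dA , _ , A#B | inj₁ p∈A = essential-⟨⟩ˡ c A B A#B p∈A (essA dA p∈A)
... | _ , dB , A#B | inj₂ p∈B =
  Essential-resp (⟨⟩-comm-tautology c B A) (essential-⟨⟩ˡ c B A (Disjoint.sym A#B) p∈B (essB dB p∈B))

essential : ∀ F → Diversified F → p ∈ᶠ F → Essential F p
essential (var r)  _ (here refl) = const true , update-≡ r
essential (A ∧' B) = essential-⟨⟩ ∧ᶜ A B (essential A) (essential B)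
essential (A ∨' B) = essential-⟨⟩ ∨ᶜ A B (essential A) (essential B)

tautology-letters : ∀ A B → Diversified B → Tautology↔ A B → p ∈ᶠ B → p ∈ᶠ A
tautology-letters {p} A B dB t p∈B with p ∈? letters A
... | yes p∈A = p∈A
... | no p∉A = contradiction (true≡false (essential B dB p∈B)) λ ()
  where
  open ≡-Reasoning
  true≡false : Essential B p → true ≡ false
  true≡false (v , h) = begin
    true                        ≡⟨ sym (h true) ⟩
    eval (v [ p ≔ true ]) B     ≡⟨ sym (t _) ⟩
    eval (v [ p ≔ true ]) A     ≡⟨ eval-update-∉ A p∉A ⟩
    eval v A                    ≡⟨ sym (eval-update-∉ A p∉A) ⟩
    eval (v [ p ≔ false ]) A    ≡⟨ t _ ⟩
    eval (v [ p ≔ false ]) B    ≡⟨ h false ⟩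
    false                       ∎

record Joins (c : Connective) (F : Formula) (p q : ℕ) : Set where
  constructor _,_
  field
    valuation : Valuation
    realises  : ∀ a b → eval (valuation [ p ≔ a ] [ q ≔ b ]) F ≡ ⟦ c ⟧ a b

Joins-resp : Tautology↔ A B → Joins c A p q → Joins c B p q
Joins-resp t (v , h) = v , λ a b → trans (sym (t _)) (h a b)

joins-across : ∀ c A B → Disjoint (letters A) (letters B) → p ∈ᶠ A → q ∈ᶠ B →
               Essential A p → Essential B q → Joins c (A ⟨ c ⟩ B) p q
joins-across {p} {q} c A B A#B p∈A q∈B (vA , hA) (vB , hB) = u , λ a b → begin
  eval (u [ p ≔ a ] [ q ≔ b ]) (A ⟨ c ⟩ B)
    ≡⟨ eval-⟨⟩ c A B ⟩
  ⟦ c ⟧ (eval (u [ p ≔ a ] [ q ≔ b ]) A) (eval (u [ p ≔ a ] [ q ≔ b ]) B)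
    ≡⟨ cong₂ ⟦ c ⟧ (eval-update-∉ A λ q∈A → A#B (q∈A , q∈B))
                   (eval-update-∉-under B (λ p∈B → A#B (p∈A , p∈B)) a b) ⟩
  ⟦ c ⟧ (eval (u [ p ≔ a ]) A) (eval (u [ q ≔ b ]) B)
    ≡⟨ cong₂ ⟦ c ⟧ (eval-cong A λ x∈A → update-cong p a (choose-yes (_∈? letters A) x∈A))
                   (eval-cong B λ x∈B → update-cong q b (choose-no (_∈? letters A) λ x∈A → A#B (x∈A , x∈B))) ⟩
  ⟦ c ⟧ (eval (vA [ p ≔ a ]) A) (eval (vB [ q ≔ b ]) B)
    ≡⟨ cong₂ ⟦ c ⟧ (hA a) (hB b) ⟩
  ⟦ c ⟧ a b ∎
  where
  open ≡-Reasoning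
  u = choose (_∈? letters A) vA vB

joins-inside : ∀ c′ A B → ¬ p ∈ᶠ B → ¬ q ∈ᶠ B → Joins c (A ⟨ c′ ⟩ B) p q → Joins c A p q
joins-inside {p} {q} {c} c′ A B p∉B q∉B (v , h) =
  v , ⟦⟧-cancelʳ c′ (eval v B) c (λ a b → eval (v [ p ≔ a ] [ q ≔ b ]) A) λ a b → begin
    ⟦ c′ ⟧ (eval (v [ p ≔ a ] [ q ≔ b ]) A) (eval v B)
      ≡⟨ cong (⟦ c′ ⟧ _) (sym (trans (eval-update-∉ B q∉B) (eval-update-∉ B p∉B))) ⟩
    ⟦ c′ ⟧ (eval (v [ p ≔ a ] [ q ≔ b ]) A) (eval (v [ p ≔ a ] [ q ≔ b ]) B)
      ≡⟨ sym (eval-⟨⟩ c′ A B) ⟩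
    eval (v [ p ≔ a ] [ q ≔ b ]) (A ⟨ c′ ⟩ B)
      ≡⟨ h a b ⟩
    ⟦ c ⟧ a b ∎
  where open ≡-Reasoning

joins-across⁻ : ∀ c′ A B → p ∈ᶠ A → ¬ p ∈ᶠ B → q ∈ᶠ B → ¬ q ∈ᶠ A →
                Joins c (A ⟨ c′ ⟩ B) p q → c′ ≡ c
joins-across⁻ {p} {q} {c} c′ A B _ p∉B _ q∉A (v , h) =
  ⟦⟧-factor c′ c (λ a → eval (v [ p ≔ a ]) A) (λ b → eval (v [ q ≔ b ]) B) λ a b → begin
    ⟦ c′ ⟧ (eval (v [ p ≔ a ]) A) (eval (v [ q ≔ b ]) B)
      ≡⟨ sym (cong₂ ⟦ c′ ⟧ (eval-update-∉ A q∉A) (eval-update-∉-under B p∉B a b)) ⟩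
    ⟦ c′ ⟧ (eval (v [ p ≔ a ] [ q ≔ b ]) A) (eval (v [ p ≔ a ] [ q ≔ b ]) B)
      ≡⟨ sym (eval-⟨⟩ c′ A B) ⟩
    eval (v [ p ≔ a ] [ q ≔ b ]) (A ⟨ c′ ⟩ B)
      ≡⟨ h a b ⟩
    ⟦ c ⟧ a b ∎
  where open ≡-Reasoning

module Splitting {P : Pred ℕ 0ℓ} (P? : Decidable P) (c : Connective) where

  JoinsAcross : Formula → Set
  JoinsAcross F = ∀ {p q} → p ∈ᶠ F → q ∈ᶠ F → P p → ¬ P q → Joins c F p q

  data Split (F : Formula) : Set where
    inside  : (_∈ᶠ F) ⊆ P → Split F
    outside : (_∈ᶠ F) ⊆ ∁ P → Split F
    split   : ∀ X Y → F ⊢↔ X ⟨ c ⟩ Y → (_∈ᶠ X) ⊆ P → (_∈ᶠ Y) ⊆ ∁ P → Split F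

  merge : Split A → Split B → Split (A ⟨ c ⟩ B)
  merge {A} {B} (inside iA) (inside iB) = inside (⊆-⟨⟩ c A B iA iB)
  merge {A} {B} (outside oA) (outside oB) = outside (⊆-⟨⟩ c A B oA oB)
  merge {A} {B} (inside iA) (outside oB) = split A B ax-refl iA oB
  merge {A} {B} (outside oA) (inside iB) = split B A (⊢-comm c) iB oA
  merge {B = B} (split X Y d iX oY) (inside iB) =
    split (X ⟨ c ⟩ B) Y (r-trans (⊢-cong c d ax-refl) (⊢-swapʳ c)) (⊆-⟨⟩ c X B iX iB) oY
  merge {B = B} (split X Y d iX oY) (outside oB) =
    split X (Y ⟨ c ⟩ B) (r-trans (⊢-cong c d ax-refl) (⊢-assoc c)) iX (⊆-⟨⟩ c Y B oY oB)
  merge {A} (inside iA) (split X Y d iX oY) =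
    split (A ⟨ c ⟩ X) Y (r-trans (⊢-cong c ax-refl d) (r-sym (⊢-assoc c))) (⊆-⟨⟩ c A X iA iX) oY
  merge {A} (outside oA) (split X Y d iX oY) =
    split X (A ⟨ c ⟩ Y) (r-trans (⊢-cong c ax-refl d) (⊢-swapˡ c)) iX (⊆-⟨⟩ c A Y oA oY)
  merge (split X₁ Y₁ d₁ iX₁ oY₁) (split X₂ Y₂ d₂ iX₂ oY₂) =
    split (X₁ ⟨ c ⟩ X₂) (Y₁ ⟨ c ⟩ Y₂) (r-trans (⊢-cong c d₁ d₂) (⊢-medial c))
          (⊆-⟨⟩ c X₁ X₂ iX₁ iX₂) (⊆-⟨⟩ c Y₁ Y₂ oY₁ oY₂)

  module _ (c′ : Connective) (A B : Formula) (A#B : Disjoint (letters A) (letters B))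
           (J : JoinsAcross (A ⟨ c′ ⟩ B)) where

    JoinsAcross-⟨⟩ˡ : JoinsAcross A
    JoinsAcross-⟨⟩ˡ p∈A q∈A Pp ¬Pq =
      joins-inside c′ A B (λ p∈B → A#B (p∈A , p∈B)) (λ q∈B → A#B (q∈A , q∈B))
        (J (∈-⟨⟩⁺ˡ c′ B p∈A) (∈-⟨⟩⁺ˡ c′ B q∈A) Pp ¬Pq)

    JoinsAcross-⟨⟩ʳ : JoinsAcross B
    JoinsAcross-⟨⟩ʳ p∈B q∈B Pp ¬Pq =
      joins-inside c′ B A (λ p∈A → A#B (p∈A , p∈B)) (λ q∈A → A#B (q∈A , q∈B))
        (Joins-resp (⟨⟩-comm-tautology c′ A B) (J (∈-⟨⟩⁺ʳ c′ A p∈B) (∈-⟨⟩⁺ʳ c′ A q∈B) Pp ¬Pq))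

    root-across : p ∈ᶠ A → q ∈ᶠ B → P p → ¬ P q → c′ ≡ c
    root-across p∈A q∈B Pp ¬Pq =
      joins-across⁻ c′ A B p∈A (λ p∈B → A#B (p∈A , p∈B)) q∈B (λ q∈A → A#B (q∈A , q∈B))
        (J (∈-⟨⟩⁺ˡ c′ B p∈A) (∈-⟨⟩⁺ʳ c′ A q∈B) Pp ¬Pq)

    root-across′ : p ∈ᶠ A → q ∈ᶠ B → ¬ P p → P q → c′ ≡ c
    root-across′ p∈A q∈B ¬Pp Pq =
      joins-across⁻ c′ B A q∈B (λ q∈A → A#B (q∈A , q∈B)) p∈A (λ p∈B → A#B (p∈A , p∈B))
        (Joins-resp (⟨⟩-comm-tautology c′ A B) (J (∈-⟨⟩⁺ʳ c′ A q∈B) (∈-⟨⟩⁺ˡ c′ B p∈A) Pq ¬Pp))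

    -- When p and q lie on the same side, a letter on the other side differs in P from one of them.
    root-mixed : p ∈ᶠ A ⟨ c′ ⟩ B → q ∈ᶠ A ⟨ c′ ⟩ B → P p → ¬ P q → c′ ≡ c
    root-mixed p∈ q∈ Pp ¬Pq with ∈-⟨⟩⁻ c′ A B p∈ | ∈-⟨⟩⁻ c′ A B q∈
    ... | inj₁ p∈A | inj₂ q∈B = root-across p∈A q∈B Pp ¬Pq
    ... | inj₂ p∈B | inj₁ q∈A = root-across′ q∈A p∈B ¬Pq Pp
    ... | inj₁ p∈A | inj₁ q∈A with some-letter B
    ...   | r , r∈B with P? r
    ...     | yes Pr = root-across′ q∈A r∈B ¬Pq Pr
    ...     | no ¬Pr = root-across p∈A r∈B Pp ¬Pr
    root-mixed p∈ q∈ Pp ¬Pq | inj₂ p∈B | inj₂ q∈B with some-letter A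
    ...   | r , r∈A with P? r
    ...     | yes Pr = root-across r∈A q∈B Pr ¬Pq
    ...     | no ¬Pr = root-across′ r∈A p∈B ¬Pr Pp

    uniform : ¬ c′ ≡ c → Split (A ⟨ c′ ⟩ B)
    uniform c′≢c with some-letter (A ⟨ c′ ⟩ B)
    ... | r , r∈ with P? r
    ...   | yes Pr = inside λ x∈ → decidable-stable (P? _) λ ¬Px → c′≢c (root-mixed r∈ x∈ Pr ¬Px)
    ...   | no ¬Pr = outside λ x∈ Px → c′≢c (root-mixed x∈ r∈ Px ¬Pr)

  splitting-⟨⟩ : ∀ c′ A B → (Diversified A → JoinsAcross A → Split A) →
                 (Diversified B → JoinsAcross B → Split B) →
                 Diversified (A ⟨ c′ ⟩ B) → JoinsAcross (A ⟨ c′ ⟩ B) → Split (A ⟨ c′ ⟩ B)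
  splitting-⟨⟩ c′ A B splitA splitB d J with Diversified-⟨⟩⁻ c′ A B d | c′ ≟ᶜ c
  ... | dA , dB , A#B | yes refl =
    merge (splitA dA (JoinsAcross-⟨⟩ˡ c A B A#B J)) (splitB dB (JoinsAcross-⟨⟩ʳ c A B A#B J))
  ... | _ , _ , A#B | no c′≢c = uniform c′ A B A#B J c′≢c

  splitting : ∀ F → Diversified F → JoinsAcross F → Split F
  splitting (var r) _ _ with P? r
  ... | yes Pr = inside λ { (here refl) → Pr }
  ... | no ¬Pr = outside λ { (here refl) → ¬Pr }
  splitting (A ∧' B) = splitting-⟨⟩ ∧ᶜ A B (splitting A) (splitting B)
  splitting (A ∨' B) = splitting-⟨⟩ ∨ᶜ A B (splitting A) (splitting B)

⟨⟩-tautology⁻ˡ : ∀ {P : Pred ℕ 0ℓ} (P? : Decidable P) c A₁ A₂ B₁ B₂ →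
                 Tautology↔ (A₁ ⟨ c ⟩ A₂) (B₁ ⟨ c ⟩ B₂) →
                 (_∈ᶠ A₁) ⊆ P → (_∈ᶠ B₁) ⊆ P → (_∈ᶠ A₂) ⊆ ∁ P → (_∈ᶠ B₂) ⊆ ∁ P →
                 Tautology↔ A₁ B₁
⟨⟩-tautology⁻ˡ P? c A₁ A₂ B₁ B₂ t A₁⊆P B₁⊆P A₂⊆∁P B₂⊆∁P v = begin
  eval v A₁             ≡⟨ eval-cong A₁ (sym ∘ choose-yes P? ∘ A₁⊆P) ⟩
  eval u A₁             ≡⟨ sym (eval-unitʳ c A₁ A₂ (choose-no P? ∘ A₂⊆∁P)) ⟩
  eval u (A₁ ⟨ c ⟩ A₂)  ≡⟨ t u ⟩
  eval u (B₁ ⟨ c ⟩ B₂)  ≡⟨ eval-unitʳ c B₁ B₂ (choose-no P? ∘ B₂⊆∁P) ⟩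
  eval u B₁             ≡⟨ eval-cong B₁ (choose-yes P? ∘ B₁⊆P) ⟩
  eval v B₁             ∎
  where
  open ≡-Reasoning
  u = choose P? v (const (unit c))

⟨⟩-tautology⁻ : ∀ {P : Pred ℕ 0ℓ} (P? : Decidable P) c A₁ A₂ B₁ B₂ →
                Tautology↔ (A₁ ⟨ c ⟩ A₂) (B₁ ⟨ c ⟩ B₂) →
                (_∈ᶠ A₁) ⊆ P → (_∈ᶠ B₁) ⊆ P → (_∈ᶠ A₂) ⊆ ∁ P → (_∈ᶠ B₂) ⊆ ∁ P →
                Tautology↔ A₁ B₁ × Tautology↔ A₂ B₂
⟨⟩-tautology⁻ P? c A₁ A₂ B₁ B₂ t A₁⊆P B₁⊆P A₂⊆∁P B₂⊆∁P =
  ⟨⟩-tautology⁻ˡ P? c A₁ A₂ B₁ B₂ t A₁⊆P B₁⊆P A₂⊆∁P B₂⊆∁P ,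
  ⟨⟩-tautology⁻ˡ (∁? P?) c A₂ A₁ B₂ B₁ t′ A₂⊆∁P B₂⊆∁P
    (λ x∈A₁ ¬Px → ¬Px (A₁⊆P x∈A₁)) (λ x∈B₁ ¬Px → ¬Px (B₁⊆P x∈B₁))
  where
  t′ : Tautology↔ (A₂ ⟨ c ⟩ A₁) (B₂ ⟨ c ⟩ B₁)
  t′ v = trans (⟨⟩-comm-tautology c A₂ A₁ v) (trans (t v) (⟨⟩-comm-tautology c B₁ B₂ v))

var-≉-⟨⟩ : ∀ c B₁ B₂ → Diversified (B₁ ⟨ c ⟩ B₂) → ¬ Tautology↔ (var p) (B₁ ⟨ c ⟩ B₂)
var-≉-⟨⟩ c B₁ B₂ d t with some-letter B₁ | some-letter B₂ | Diversified-⟨⟩⁻ c B₁ B₂ d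
... | x , x∈B₁ | y , y∈B₂ | _ , _ , B₁#B₂
  with tautology-letters (var _) (B₁ ⟨ c ⟩ B₂) d t (∈-⟨⟩⁺ˡ c B₂ x∈B₁)
     | tautology-letters (var _) (B₁ ⟨ c ⟩ B₂) d t (∈-⟨⟩⁺ʳ c B₁ y∈B₂)
... | here refl | here refl = B₁#B₂ (x∈B₁ , y∈B₂)

Complete : Formula → Set
Complete A = ∀ B → Diversified A → Diversified B → Tautology↔ A B → A ⊢↔ B

complete-var : ∀ p → Complete (var p)
complete-var p (var r) _ dB t with tautology-letters (var p) (var r) dB t (here refl)
... | here refl = ax-refl
complete-var p (B₁ ∧' B₂) _ dB t = ⊥-elim (var-≉-⟨⟩ ∧ᶜ B₁ B₂ dB t)
complete-var p (B₁ ∨' B₂) _ dB t = ⊥-elim (var-≉-⟨⟩ ∨ᶜ B₁ B₂ dB t)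

complete-⟨⟩ : ∀ c A₁ A₂ → Complete A₁ → Complete A₂ → Complete (A₁ ⟨ c ⟩ A₂)
complete-⟨⟩ c A₁ A₂ complete₁ complete₂ B dA dB t with Diversified-⟨⟩⁻ c A₁ A₂ dA
... | dA₁ , dA₂ , A₁#A₂ = from-split (splitting B dB joins-across-B)
  where
  open Splitting (_∈? letters A₁) c

  in-A₂ : q ∈ᶠ B → ¬ q ∈ᶠ A₁ → q ∈ᶠ A₂
  in-A₂ q∈B q∉A₁ = [ ⊥-elim ∘ q∉A₁ , id ] (∈-⟨⟩⁻ c A₁ A₂ (tautology-letters (A₁ ⟨ c ⟩ A₂) B dB t q∈B))

  joins-across-B : JoinsAcross B
  joins-across-B p∈B q∈B p∈A₁ q∉A₁ =
    Joins-resp t (joins-across c A₁ A₂ A₁#A₂ p∈A₁ (in-A₂ q∈B q∉A₁)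
                   (essential A₁ dA₁ p∈A₁) (essential A₂ dA₂ (in-A₂ q∈B q∉A₁)))

  in-B : p ∈ᶠ A₁ ⟨ c ⟩ A₂ → p ∈ᶠ B
  in-B = tautology-letters B (A₁ ⟨ c ⟩ A₂) dA (sym ∘ t)

  from-split : Split B → A₁ ⟨ c ⟩ A₂ ⊢↔ B
  from-split (inside B⊆A₁) =
    let q , q∈A₂ = some-letter A₂ in ⊥-elim (A₁#A₂ (B⊆A₁ (in-B (∈-⟨⟩⁺ʳ c A₁ q∈A₂)) , q∈A₂))
  from-split (outside B⊆∁A₁) =
    let p , p∈A₁ = some-letter A₁ in ⊥-elim (B⊆∁A₁ (in-B (∈-⟨⟩⁺ˡ c A₂ p∈A₁)) p∈A₁)
  from-split (split X Y d X⊆A₁ Y⊆∁A₁)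
    with Diversified-⟨⟩⁻ c X Y (Diversified-resp-⊢↔ d dB)
       | ⟨⟩-tautology⁻ (_∈? letters A₁) c A₁ A₂ X Y (λ v → trans (t v) (soundness d v))
           id X⊆A₁ (λ x∈A₂ x∈A₁ → A₁#A₂ (x∈A₁ , x∈A₂)) Y⊆∁A₁
  ... | dX , dY , _ | t₁ , t₂ =
    r-trans (⊢-cong c (complete₁ X dA₁ dX t₁) (complete₂ Y dA₂ dY t₂)) (r-sym d)

complete : ∀ A → Complete A
complete (var p)  = complete-var p
complete (A ∧' B) = complete-⟨⟩ ∧ᶜ A B (complete A) (complete B)
complete (A ∨' B) = complete-⟨⟩ ∨ᶜ A B (complete A) (complete B)

proposition1 : (A B : Formula) → Diversified A → Diversified B →
               (Tautology↔ A B ⇔ (A ⊢↔ B))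
proposition1 A B dA dB = mk⇔ (complete A B dA dB) soundness
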